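{- Let $G$ be a finite simple graph with vertex set $[m]$ and edge set $E(G)$, and let $\Delta_T(G)$ be its total simplicial complex. Then $\mathrm{link}_{\Delta_T(G)}(\emptyset)$ (which equals $\Delta_T(G)$) is connected if and only if $G$ is connected.
   Context: Total simplicial complex: for a finite simple graph $G$ with vertex set $[m]$ and edge set $E(G)$, the set of total indices $\Upsilon_T(G)$ is the collection of subsets of $[m]\cup E(G)$ consisting of the sets $\{p,q,r\}$ such that (i) $p,q,r$ are adjacent vertices in $G$; or (ii) $p,q,r$ are adjacent edges in $G$; or (iii) $p$ and $q$ are adjacent vertices and $r$ is an edge incident to $p$ or $q$; or (iv) $p$ and $q$ are adjacent edges and $r$ is a vertex incident to $p$ or $q$; together with the singletons $\{p\}$ for each isolated vertex $p$ of $G$. The total simplicial complex $\Delta_T(G)$ is the simplicial complex on vertex set $[m]\cup E(G)$ generated by (i.e. whose facets are the maximal elements among) the sets in $\Upsilon_T(G)$. For a simplicial complex $\Delta$ and face $\sigma$, $\mathrm{link}_\Delta(\sigma)=\{\tau\in\Delta : \tau\cap\sigma=\emptyset,\ \tau\cup\sigma\in\Delta\}$. A simplicial complex is connected if for any two facets $\sigma,\bar\sigma$ there is a sequence of facets $\sigma=\sigma_0,\sigma_1,\ldots,\sigma_i=\bar\sigma$ with $\sigma_j\cap\sigma_{j+1}\neq\emptyset$ for all $j$. -}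

module Defs where

import Level
open import Level using (0ℓ)
open import Data.Nat using (ℕ)
open import Data.Bool using (Bool; true; false)
open import Data.Fin using (Fin; _<_)
open import Data.Product using (Σ; ∃; ∃-syntax; _×_; _,_)
open import Data.Sum using (_⊎_)
open import Data.Empty using (⊥)
open import Relation.Nullary using (¬_)
open import Relation.Binary.PropositionalEquality using (_≡_)
open import Relation.Unary using (Pred; _⊆_; _≐_; _∪_; _∩_; ∅)

record Graph (m : ℕ) : Set where
  field
    adj   : Fin m → Fin m → Bool
    sym   : ∀ i j → adj i j ≡ adj j i
    irref : ∀ i → adj i i ≡ false

module _ {m : ℕ} (G : Graph m) where
  open Graph G

  Adjacent : Fin m → Fin m → Set
  Adjacent i j = adj i j ≡ true

  -- The edge set E(G): unordered pairs {i,j}, represented with i < j.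
  Edge : Set
  Edge = Σ (Fin m) λ i → Σ (Fin m) λ j → (i < j) × Adjacent i j

  Incident : Fin m → Edge → Set
  Incident v (i , j , _) = (v ≡ i) ⊎ (v ≡ j)

  AdjacentEdges : Edge → Edge → Set
  AdjacentEdges e f = ¬ (e ≡ f) × ∃[ v ] (Incident v e × Incident v f)

  Isolated : Fin m → Set
  Isolated p = ∀ q → adj p q ≡ false

  Ground : Set
  Ground = Fin m ⊎ Edge

  vtx : Fin m → Ground
  vtx = Data.Sum.inj₁

  edg : Edge → Ground
  edg = Data.Sum.inj₂

  Triple : Ground → Ground → Ground → Pred Ground 0ℓ
  Triple a b c x = (x ≡ a) ⊎ (x ≡ b) ⊎ (x ≡ c)

  Single : Ground → Pred Ground 0ℓ
  Single a x = x ≡ a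

  TotalTriple : Pred Ground 0ℓ → Set
  TotalTriple σ =
      (∃[ p ] ∃[ q ] ∃[ r ]
         (Adjacent p q × Adjacent q r × Adjacent p r)
         × σ ≐ Triple (vtx p) (vtx q) (vtx r))
    ⊎ (∃[ p ] ∃[ q ] ∃[ r ]
         (AdjacentEdges p q × AdjacentEdges q r × AdjacentEdges p r)
         × σ ≐ Triple (edg p) (edg q) (edg r))
    ⊎ (∃[ p ] ∃[ q ] ∃[ r ]
         (Adjacent p q × (Incident p r ⊎ Incident q r))
         × σ ≐ Triple (vtx p) (vtx q) (edg r))
    ⊎ (∃[ p ] ∃[ q ] ∃[ r ]
         (AdjacentEdges p q × (Incident r p ⊎ Incident r q))
         × σ ≐ Triple (edg p) (edg q) (vtx r))

  TotalIndex : Pred (Pred Ground 0ℓ) 0ℓ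
  TotalIndex σ = TotalTriple σ ⊎ (∃[ p ] Isolated p × σ ≐ Single (vtx p))

module _ {X : Set} where

  Generated : Pred (Pred X 0ℓ) 0ℓ → Pred (Pred X 0ℓ) (Level.suc 0ℓ)
  Generated Υ σ = ∃[ υ ] (Υ υ × σ ⊆ υ)

  link : Pred (Pred X 0ℓ) (Level.suc 0ℓ) → Pred X 0ℓ → Pred (Pred X 0ℓ) (Level.suc 0ℓ)
  link Δ σ τ = Δ τ × (∀ x → τ x → σ x → ⊥) × Δ (τ ∪ σ)

  Facet : Pred (Pred X 0ℓ) (Level.suc 0ℓ) → Pred X 0ℓ → Set₁
  Facet Δ σ = Δ σ × (∀ τ → Δ τ → σ ⊆ τ → τ ⊆ σ)

  Meets : Pred X 0ℓ → Pred X 0ℓ → Set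
  Meets σ τ = ∃[ x ] (σ x × τ x)

  data FacetChain (Δ : Pred (Pred X 0ℓ) (Level.suc 0ℓ)) : Pred X 0ℓ → Pred X 0ℓ → Set₁ where
    done : ∀ {σ} → FacetChain Δ σ σ
    step : ∀ {σ σ₁ σ'} → Facet Δ σ₁ → Meets σ σ₁ → FacetChain Δ σ₁ σ' → FacetChain Δ σ σ'

  ConnectedComplex : Pred (Pred X 0ℓ) (Level.suc 0ℓ) → Set₁
  ConnectedComplex Δ = ∀ σ σ' → Facet Δ σ → Facet Δ σ' → FacetChain Δ σ σ'

ΔT : ∀ {m} (G : Graph m) → Pred (Pred (Ground G) 0ℓ) (Level.suc 0ℓ)
ΔT G = Generated (TotalIndex G)

data Walk {m : ℕ} (G : Graph m) : Fin m → Fin m → Set where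
  here  : ∀ {i} → Walk G i i
  there : ∀ {i k j} → Adjacent G i k → Walk G k j → Walk G i j

ConnectedGraph : ∀ {m} → Graph m → Set
ConnectedGraph {m} G = ∀ (i j : Fin m) → Walk G i j

{-# OPTIONS --safe #-}
module Submission where

-- Send every element of the ground set to a vertex: a vertex to itself, an edge to one of its
-- endpoints.  Each generating set of Δ_T(G) has a vertex from which all of its elements are
-- reachable in G, so along a chain of facets reachability from a fixed vertex propagates;
-- this gives connectivity of G.  Conversely, every vertex lies in a facet (the closed edge
-- {i, j, ij} or, if it is isolated, the singleton), consecutive vertices of a walk lie in
-- consecutive closed edges, and an edge in a facet meets its closed edge.

open import Defs
open import Data.Nat using (ℕ)
open import Relation.Unary using (∅)
open import Function.Bundles using (_⇔_; mk⇔)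
import Level
open import Level using (0ℓ)
open import Function.Base using (_∘_)
open import Data.Bool using (true; _≟_)
open import Data.Bool.Properties using (¬-not)
open import Data.Fin using (Fin; _<_)
open import Data.Fin.Properties using (<-cmp; <⇒≢; any?)
open import Data.Product using (∃; ∃-syntax; _×_; _,_; proj₁; proj₂)
open import Data.Sum using (_⊎_; inj₁; inj₂; [_,_]; map₂)
open import Data.Sum.Properties using (inj₁-injective)
open import Data.Empty using (⊥-elim)
open import Relation.Nullary using (¬_; yes; no)
open import Relation.Binary.Definitions using (tri<; tri≈; tri>)
open import Relation.Binary.PropositionalEquality using (_≡_; refl; sym; trans)
open import Relation.Unary using (Pred; _⊆_)
open import Relation.Unary.Properties using (≐-refl)

pair-⊆ : {A : Set} {i j p q : A} → ¬ i ≡ j → i ≡ p ⊎ i ≡ q → j ≡ p ⊎ j ≡ q →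
         (p ≡ i ⊎ p ≡ j) × (q ≡ i ⊎ q ≡ j)
pair-⊆ i≢j (inj₁ refl) (inj₁ refl) = ⊥-elim (i≢j refl)
pair-⊆ i≢j (inj₁ refl) (inj₂ refl) = inj₁ refl , inj₂ refl
pair-⊆ i≢j (inj₂ refl) (inj₁ refl) = inj₂ refl , inj₁ refl
pair-⊆ i≢j (inj₂ refl) (inj₂ refl) = ⊥-elim (i≢j refl)

module _ {X : Set} {Δ : Pred (Pred X 0ℓ) (Level.suc 0ℓ)} where

  _++ᶜ_ : ∀ {σ τ ρ} → FacetChain Δ σ τ → FacetChain Δ τ ρ → FacetChain Δ σ ρ
  done          ++ᶜ c = c
  step f meet c ++ᶜ d = step f meet (c ++ᶜ d)

  FacetChain-⊆ : {P : Pred X 0ℓ} → (∀ {σ x y} → Δ σ → σ x → σ y → P x → P y) →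
                 ∀ {σ σ′} → FacetChain Δ σ σ′ → σ ⊆ P → σ′ ⊆ P
  FacetChain-⊆ closed done σ⊆P = σ⊆P
  FacetChain-⊆ closed (step (face , _) (x , σx , σ₁x) c) σ⊆P =
    FacetChain-⊆ closed c (λ σ₁y → closed face σ₁x σ₁y (σ⊆P σx))

module _ {X : Set} {Υ : Pred (Pred X 0ℓ) 0ℓ} where

  generator-face : ∀ {υ σ} → Υ υ → σ ⊆ υ → link (Generated Υ) ∅ σ
  generator-face {υ} Υυ σ⊆υ =
    (υ , Υυ , σ⊆υ) , (λ _ _ ()) , (υ , Υυ , [ σ⊆υ , (λ ()) ])

  maximal-generator-facet : ∀ {υ} → Υ υ → (∀ {υ′} → Υ υ′ → υ ⊆ υ′ → υ′ ⊆ υ) →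
                            Facet (link (Generated Υ) ∅) υ
  maximal-generator-facet Υυ maximal =
    generator-face Υυ (λ υx → υx) ,
    λ { τ ((υ′ , Υυ′ , τ⊆υ′) , _) υ⊆τ τx → maximal Υυ′ (λ υx → τ⊆υ′ (υ⊆τ υx)) (τ⊆υ′ τx) }

  facet-nonempty : (∀ {υ} → Υ υ → ∃ υ) → ∀ {σ} → Facet (link (Generated Υ) ∅) σ → ∃ σ
  facet-nonempty nonempty (((υ , Υυ , σ⊆υ) , _) , maximal) with nonempty Υυ
  ... | x , υx = x , maximal υ (generator-face Υυ (λ υx → υx)) σ⊆υ υx

module _ {m : ℕ} (G : Graph m) where

  private
    Δ : Pred (Pred (Ground G) 0ℓ) (Level.suc 0ℓ)
    Δ = link (ΔT G) ∅

  Adjacent-sym : ∀ {i j} → Adjacent G i j → Adjacent G j i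
  Adjacent-sym {i} {j} ij = trans (Graph.sym G j i) ij

  _++ʷ_ : ∀ {i j k} → Walk G i j → Walk G j k → Walk G i k
  here       ++ʷ w = w
  there ij v ++ʷ w = there ij (v ++ʷ w)

  reverseʷ : ∀ {i j} → Walk G i j → Walk G j i
  reverseʷ here         = here
  reverseʷ (there ij w) = reverseʷ w ++ʷ there (Adjacent-sym ij) here

  Triple-⊆ : ∀ (P : Pred (Ground G) 0ℓ) {a b c} → P a → P b → P c → Triple G a b c ⊆ P
  Triple-⊆ _ Pa Pb Pc (inj₁ refl)        = Pa
  Triple-⊆ _ Pa Pb Pc (inj₂ (inj₁ refl)) = Pb
  Triple-⊆ _ Pa Pb Pc (inj₂ (inj₂ refl)) = Pc

  Triple-¬₃ : ∀ {a b c x} → ¬ x ≡ c → Triple G a b c x → x ≡ a ⊎ x ≡ b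
  Triple-¬₃ x≢c (inj₁ x≡a)        = inj₁ x≡a
  Triple-¬₃ x≢c (inj₂ (inj₁ x≡b)) = inj₂ x≡b
  Triple-¬₃ x≢c (inj₂ (inj₂ x≡c)) = ⊥-elim (x≢c x≡c)

  Triple-¬₁₂ : ∀ {a b c x} → ¬ x ≡ a → ¬ x ≡ b → Triple G a b c x → x ≡ c
  Triple-¬₁₂ x≢a x≢b (inj₁ x≡a)        = ⊥-elim (x≢a x≡a)
  Triple-¬₁₂ x≢a x≢b (inj₂ (inj₁ x≡b)) = ⊥-elim (x≢b x≡b)
  Triple-¬₁₂ x≢a x≢b (inj₂ (inj₂ x≡c)) = x≡c

  Triple-∌ : ∀ {a b c x} → ¬ x ≡ a → ¬ x ≡ b → ¬ x ≡ c → ¬ Triple G a b c x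
  Triple-∌ x≢a x≢b x≢c = x≢c ∘ Triple-¬₁₂ x≢a x≢b

  anchor : Ground G → Fin m
  anchor (inj₁ v)       = v
  anchor (inj₂ (i , _)) = i

  _⇝_ : Fin m → Ground G → Set
  z ⇝ x = Walk G z (anchor x)

  incident-walk : ∀ {v} e → Incident G v e → v ⇝ edg G e
  incident-walk (i , j , _ , ij) (inj₁ refl) = here
  incident-walk (i , j , _ , ij) (inj₂ refl) = there (Adjacent-sym ij) here

  adjacentEdges-walk : ∀ {e f} → AdjacentEdges G e f → anchor (edg G e) ⇝ edg G f
  adjacentEdges-walk {e} {f} (_ , v , ve , vf) =
    reverseʷ (incident-walk e ve) ++ʷ incident-walk f vf

  TotalIndex-hub : ∀ {υ} → TotalIndex G υ → ∃[ z ] (υ ⊆ z ⇝_)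
  TotalIndex-hub (inj₁ (inj₁ (p , q , r , (pq , _ , pr) , υ⊆ , _))) =
    p , λ υx → Triple-⊆ (p ⇝_) here (there pq here) (there pr here) (υ⊆ υx)
  TotalIndex-hub (inj₁ (inj₂ (inj₁ (p , q , r , (pq , _ , pr) , υ⊆ , _)))) =
    anchor (edg G p) ,
    λ υx → Triple-⊆ (anchor (edg G p) ⇝_) here (adjacentEdges-walk pq) (adjacentEdges-walk pr) (υ⊆ υx)
  TotalIndex-hub (inj₁ (inj₂ (inj₂ (inj₁ (p , q , r , (pq , inj₁ pr) , υ⊆ , _))))) =
    p , λ υx → Triple-⊆ (p ⇝_) here (there pq here) (incident-walk r pr) (υ⊆ υx)
  TotalIndex-hub (inj₁ (inj₂ (inj₂ (inj₁ (p , q , r , (pq , inj₂ qr) , υ⊆ , _))))) =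
    p , λ υx → Triple-⊆ (p ⇝_) here (there pq here) (there pq (incident-walk r qr)) (υ⊆ υx)
  TotalIndex-hub (inj₁ (inj₂ (inj₂ (inj₂ (p , q , r , (pq , inj₁ rp) , υ⊆ , _))))) =
    r , λ υx → Triple-⊆ (r ⇝_) (incident-walk p rp) (incident-walk p rp ++ʷ adjacentEdges-walk pq)
                        here (υ⊆ υx)
  TotalIndex-hub (inj₁ (inj₂ (inj₂ (inj₂ (p , q , r , (pq , inj₂ rq) , υ⊆ , _))))) =
    r , λ υx → Triple-⊆ (r ⇝_) (incident-walk q rq ++ʷ reverseʷ (adjacentEdges-walk pq))
                        (incident-walk q rq) here (υ⊆ υx)
  TotalIndex-hub (inj₂ (p , _ , υ⊆ , _)) = p , λ υx → hub (υ⊆ υx)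
    where
      hub : ∀ {x} → x ≡ vtx G p → p ⇝ x
      hub refl = here

  ⇝-closed-in-face : ∀ i {σ x y} → Δ σ → σ x → σ y → i ⇝ x → i ⇝ y
  ⇝-closed-in-face i ((υ , t , σ⊆υ) , _) σx σy i⇝x with TotalIndex-hub t
  ... | z , υ⊆z⇝ = i⇝x ++ʷ (reverseʷ (υ⊆z⇝ (σ⊆υ σx)) ++ʷ υ⊆z⇝ (σ⊆υ σy))

  TotalIndex-nonempty : ∀ {υ} → TotalIndex G υ → ∃ υ
  TotalIndex-nonempty (inj₁ (inj₁ (_ , _ , _ , _ , _ , ⊇υ)))               = _ , ⊇υ (inj₁ refl)
  TotalIndex-nonempty (inj₁ (inj₂ (inj₁ (_ , _ , _ , _ , _ , ⊇υ))))        = _ , ⊇υ (inj₁ refl)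
  TotalIndex-nonempty (inj₁ (inj₂ (inj₂ (inj₁ (_ , _ , _ , _ , _ , ⊇υ))))) = _ , ⊇υ (inj₁ refl)
  TotalIndex-nonempty (inj₁ (inj₂ (inj₂ (inj₂ (_ , _ , _ , _ , _ , ⊇υ))))) = _ , ⊇υ (inj₁ refl)
  TotalIndex-nonempty (inj₂ (_ , _ , _ , ⊇υ))                              = _ , ⊇υ refl

  closedEdge : Edge G → Pred (Ground G) 0ℓ
  closedEdge e@(i , j , _) = Triple G (vtx G i) (vtx G j) (edg G e)

  closedEdge-∋ : ∀ {v} e → Incident G v e → closedEdge e (vtx G v)
  closedEdge-∋ e (inj₁ refl) = inj₁ refl
  closedEdge-∋ e (inj₂ refl) = inj₂ (inj₁ refl)

  <⇒vtx≢ : ∀ {i j} → i < j → ¬ vtx G i ≡ vtx G j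
  <⇒vtx≢ i<j = <⇒≢ i<j ∘ inj₁-injective

  closedEdge-maximal : ∀ e {υ} → TotalIndex G υ → closedEdge e ⊆ υ → υ ⊆ closedEdge e
  closedEdge-maximal e (inj₁ (inj₁ (_ , _ , _ , _ , υ⊆ , _))) e⊆υ =
    ⊥-elim (Triple-∌ (λ ()) (λ ()) (λ ()) (υ⊆ (e⊆υ (inj₂ (inj₂ refl)))))
  closedEdge-maximal e (inj₁ (inj₂ (inj₁ (_ , _ , _ , _ , υ⊆ , _)))) e⊆υ =
    ⊥-elim (Triple-∌ (λ ()) (λ ()) (λ ()) (υ⊆ (e⊆υ (inj₁ refl))))
  closedEdge-maximal e@(i , j , i<j , _) (inj₁ (inj₂ (inj₂ (inj₁ (p , q , r , _ , υ⊆ , _))))) e⊆υ =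
    λ υx → Triple-⊆ (closedEdge e) (map₂ inj₁ (proj₁ p,q∈ij)) (map₂ inj₁ (proj₂ p,q∈ij))
                    (inj₂ (inj₂ (sym e≡r))) (υ⊆ υx)
    where
      p,q∈ij : (vtx G p ≡ vtx G i ⊎ vtx G p ≡ vtx G j) × (vtx G q ≡ vtx G i ⊎ vtx G q ≡ vtx G j)
      p,q∈ij = pair-⊆ (<⇒vtx≢ i<j) (Triple-¬₃ (λ ()) (υ⊆ (e⊆υ (inj₁ refl))))
                                             (Triple-¬₃ (λ ()) (υ⊆ (e⊆υ (inj₂ (inj₁ refl)))))
      e≡r : edg G e ≡ edg G r
      e≡r = Triple-¬₁₂ (λ ()) (λ ()) (υ⊆ (e⊆υ (inj₂ (inj₂ refl))))
  closedEdge-maximal (_ , _ , i<j , _) (inj₁ (inj₂ (inj₂ (inj₂ (_ , _ , _ , _ , υ⊆ , _))))) e⊆υ =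
    ⊥-elim (<⇒vtx≢ i<j (trans (Triple-¬₁₂ (λ ()) (λ ()) (υ⊆ (e⊆υ (inj₁ refl))))
                                  (sym (Triple-¬₁₂ (λ ()) (λ ()) (υ⊆ (e⊆υ (inj₂ (inj₁ refl))))))))
  closedEdge-maximal (_ , _ , i<j , _) (inj₂ (_ , _ , υ⊆ , _)) e⊆υ =
    ⊥-elim (<⇒vtx≢ i<j (trans (υ⊆ (e⊆υ (inj₁ refl))) (sym (υ⊆ (e⊆υ (inj₂ (inj₁ refl)))))))

  closedEdge-facet : ∀ e → Facet Δ (closedEdge e)
  closedEdge-facet e@(i , j , _ , ij) =
    maximal-generator-facet
      (inj₁ (inj₂ (inj₂ (inj₁ (i , j , e , (ij , inj₁ (inj₁ refl)) , ≐-refl)))))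
      (closedEdge-maximal e)

  incident⇒adjacent : ∀ {v} e → Incident G v e → ∃[ k ] Adjacent G v k
  incident⇒adjacent (i , j , _ , ij) (inj₁ refl) = j , ij
  incident⇒adjacent (i , j , _ , ij) (inj₂ refl) = i , Adjacent-sym ij

  TotalTriple-vertex-adjacent : ∀ {σ v} → TotalTriple G σ → σ (vtx G v) → ∃[ k ] Adjacent G v k
  TotalTriple-vertex-adjacent (inj₁ (p , q , r , (pq , qr , pr) , σ⊆ , _)) σv with σ⊆ σv
  ... | inj₁ refl        = q , pq
  ... | inj₂ (inj₁ refl) = r , qr
  ... | inj₂ (inj₂ refl) = p , Adjacent-sym pr
  TotalTriple-vertex-adjacent (inj₂ (inj₁ (_ , _ , _ , _ , σ⊆ , _))) σv with σ⊆ σv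
  ... | inj₁ ()
  ... | inj₂ (inj₁ ())
  ... | inj₂ (inj₂ ())
  TotalTriple-vertex-adjacent (inj₂ (inj₂ (inj₁ (p , q , r , (pq , _) , σ⊆ , _)))) σv with σ⊆ σv
  ... | inj₁ refl        = q , pq
  ... | inj₂ (inj₁ refl) = p , Adjacent-sym pq
  ... | inj₂ (inj₂ ())
  TotalTriple-vertex-adjacent (inj₂ (inj₂ (inj₂ (p , q , r , (_ , rp∨rq) , σ⊆ , _)))) σv with σ⊆ σv
  ... | inj₁ ()
  ... | inj₂ (inj₁ ())
  ... | inj₂ (inj₂ refl) = [ incident⇒adjacent p , incident⇒adjacent q ] rp∨rq

  isolated-¬adjacent : ∀ {i k} → Isolated G i → ¬ Adjacent G i k
  isolated-¬adjacent {k = k} iso ik with () ← trans (sym ik) (iso k)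

  isolated-facet : ∀ {i} → Isolated G i → Facet Δ (Single G (vtx G i))
  isolated-facet {i} iso = maximal-generator-facet (inj₂ (i , iso , ≐-refl)) maximal
    where
      maximal : ∀ {υ} → TotalIndex G υ → Single G (vtx G i) ⊆ υ → υ ⊆ Single G (vtx G i)
      maximal (inj₁ t) i⊆υ _ =
        ⊥-elim (isolated-¬adjacent iso (proj₂ (TotalTriple-vertex-adjacent t (i⊆υ refl))))
      maximal (inj₂ (_ , _ , υ⊆ , _)) i⊆υ υx = trans (υ⊆ υx) (sym (υ⊆ (i⊆υ refl)))

  adjacent⇒edge : ∀ {u k} → Adjacent G u k → ∃[ e ] (Incident G u e × Incident G k e)
  adjacent⇒edge {u} {k} uk with <-cmp u k
  ... | tri< u<k _ _ = (u , k , u<k , uk) , inj₁ refl , inj₂ refl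
  ... | tri≈ _ refl _ with () ← trans (sym uk) (Graph.irref G u)
  ... | tri> _ _ k<u = (k , u , k<u , Adjacent-sym uk) , inj₂ refl , inj₁ refl

  adjacent-or-isolated : ∀ i → (∃[ k ] Adjacent G i k) ⊎ Isolated G i
  adjacent-or-isolated i with any? (λ k → Graph.adj G i k ≟ true)
  ... | yes adjacent = inj₁ adjacent
  ... | no none      = inj₂ (λ k → ¬-not (λ ik → none (k , ik)))

  vertex-facet : ∀ i → ∃[ σ ] (Facet Δ σ × σ (vtx G i))
  vertex-facet i with adjacent-or-isolated i
  ... | inj₂ iso = Single G (vtx G i) , isolated-facet iso , refl
  ... | inj₁ (k , ik) with adjacent⇒edge ik
  ...   | e , ie , _ = closedEdge e , closedEdge-facet e , closedEdge-∋ e ie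

  connectedComplex⇒connectedGraph : ConnectedComplex Δ → ConnectedGraph G
  connectedComplex⇒connectedGraph connected i j
    with vertex-facet i | vertex-facet j
  ... | σ , σ-facet , σi | σ′ , σ′-facet , σ′j =
    FacetChain-⊆ (⇝-closed-in-face i) (connected σ σ′ σ-facet σ′-facet)
                 (λ σx → ⇝-closed-in-face i (proj₁ σ-facet) σi σx here) σ′j

  walk⇒FacetChain : ∀ {u w τ τ′} → Walk G u w → Facet Δ τ → τ (vtx G u) →
                    Facet Δ τ′ → τ′ (vtx G w) → FacetChain Δ τ τ′
  walk⇒FacetChain here _ τu τ′-facet τ′w = step τ′-facet (_ , τu , τ′w) done
  walk⇒FacetChain (there uk w) _ τu τ′-facet τ′w with adjacent⇒edge uk
  ... | e , ue , ke =
    step (closedEdge-facet e) (_ , τu , closedEdge-∋ e ue)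
         (walk⇒FacetChain w (closedEdge-facet e) (closedEdge-∋ e ke) τ′-facet τ′w)

  anchor-facet : ∀ {σ x} → Facet Δ σ → σ x →
                 ∃[ τ ] (Facet Δ τ × τ (vtx G (anchor x)) × FacetChain Δ σ τ × FacetChain Δ τ σ)
  anchor-facet {x = inj₁ _} σ-facet σx = _ , σ-facet , σx , done , done
  anchor-facet {x = inj₂ e} σ-facet σe =
    closedEdge e , closedEdge-facet e , inj₁ refl ,
    step (closedEdge-facet e) (_ , σe , inj₂ (inj₂ refl)) done ,
    step σ-facet (_ , inj₂ (inj₂ refl) , σe) done

  connectedGraph⇒connectedComplex : ConnectedGraph G → ConnectedComplex Δ
  connectedGraph⇒connectedComplex connected σ σ′ σ-facet σ′-facet
    with facet-nonempty TotalIndex-nonempty σ-facet | facet-nonempty TotalIndex-nonempty σ′-facet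
  ... | x , σx | y , σ′y
    with anchor-facet σ-facet σx | anchor-facet σ′-facet σ′y
  ... | τ , τ-facet , τx , σ→τ , _ | τ′ , τ′-facet , τ′y , _ , τ′→σ′ =
    σ→τ ++ᶜ (walk⇒FacetChain (connected (anchor x) (anchor y)) τ-facet τx τ′-facet τ′y ++ᶜ τ′→σ′)

lemma3p1 : ∀ (m : ℕ) (G : Graph m) →
    ConnectedComplex (link (ΔT G) ∅) ⇔ ConnectedGraph G
lemma3p1 m G = mk⇔ (connectedComplex⇒connectedGraph G) (connectedGraph⇒connectedComplex G)
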